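{- Let $f$ be a fitness landscape on $n$ bits that is both conditionally-smooth (say $\prec$-smooth) and semismooth. Then KernighanLin takes at most $\mathrm{height}_f(x^0)$ steps to reach the peak from an initial assignment $x^0$.
   Context: A fitness landscape is $f:\{0,1\}^n\to\mathbb{Z}$; $x[i\mapsto b]$ is $x$ with bit $i$ set to $b$, $\bar b=1-b$, $x[S]$ the restriction to $S$. Let $\phi^+(x)=\{i: f(x[i\mapsto\bar x_i])>f(x)\}$, $\phi^-(x)=[n]\setminus\phi^+(x)$; $x$ is a local peak if $\phi^+(x)=\emptyset$. For a strict partial order $\prec$ on $[n]$ and $\downarrow j=\{i:i\prec j\}$, $f$ is $\prec$-smooth with optimum $x^*$ if for all $j$ and all $x$ with $x[\downarrow j]=x^*[\downarrow j]$, $f(x[j\mapsto x^*_j])>f(x[j\mapsto\overline{x^*_j}])$; $x^*$ is then the unique local peak ("the peak"). For $S\subseteq[n]$ and $y\in\{0,1\}^{[n]\setminus S}$, the face $\{0,1\}^Sy$ is the set of $x$ with $x[[n]\setminus S]=y$; $x$ is a local peak of the face if $f(x)\ge f(x[i\mapsto\bar x_i])$ for all $i\in S$. $f$ is semismooth if every face has exactly one local peak. Define $\phi^\ominus(x)=\{i: j\in\phi^-(x)\text{ for all }j\preceq i\}$; $\mathrm{height}_f(x)$ is the maximum chain size of $([n]\setminus\phi^\ominus(x),\prec)$. The Kernighan–Lin neighbourhood $\mathrm{KLN}_f(x)$: start with $S=[n]$, $y=x$, list empty; while $S\ne\emptyset$, let $i\in S$ be the lowest index maximizing $f(y[i\mapsto\bar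 y_i])$ over $i\in S$, append $y[i\mapsto\bar y_i]$ to the list, set $y\gets y[i\mapsto\bar y_i]$ and $S\gets S\setminus\{i\}$. KernighanLin: while the current assignment $x$ is not a local peak, move to an element of $\mathrm{KLN}_f(x)$ of maximum fitness; each move is one step. -}

module Defs where

open import Data.Bool using (Bool; true; false; not)
open import Data.Nat using (ℕ; zero; suc)
open import Data.Integer using (ℤ; _≤_; _<_; _<?_)
open import Data.Fin using (Fin)
open import Data.Vec using (Vec; lookup; _[_]≔_; allFin; toList)
open import Data.List using (List; []; _∷_; length)
open import Data.List.Membership.Propositional using (_∈_)
open import Data.List.Relation.Unary.All using (All)
open import Data.List.Relation.Unary.Linked using (Linked)
open import Data.Maybe using (Maybe; just; nothing)
open import Data.Product using (_×_; _,_; ∃-syntax)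
open import Data.Sum using (_⊎_)
open import Relation.Nullary using (¬_; yes; no)
open import Relation.Binary using (Rel)
open import Relation.Binary.PropositionalEquality using (_≡_)
open import Level using (0ℓ)

Assignment : ℕ → Set
Assignment n = Vec Bool n

upd : ∀ {n} → Assignment n → Fin n → Bool → Assignment n
upd x i b = x [ i ]≔ b

flipAt : ∀ {n} → Assignment n → Fin n → Assignment n
flipAt x i = upd x i (not (lookup x i))

Landscape : ℕ → Set
Landscape n = Assignment n → ℤ

module _ {n : ℕ} (f : Landscape n) where

  InPhiPlus : Assignment n → Fin n → Set
  InPhiPlus x i = f x < f (flipAt x i)

  InPhiMinus : Assignment n → Fin n → Set
  InPhiMinus x i = ¬ InPhiPlus x i

  LocalPeak : Assignment n → Set
  LocalPeak x = ∀ i → ¬ InPhiPlus x i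

  -- Faces: a face {0,1}^S y is represented by the subset S (S i ≡ true
  -- means i ∈ S) and any assignment z agreeing with y outside S.
  InFace : Vec Bool n → Assignment n → Assignment n → Set
  InFace S z x = ∀ i → lookup S i ≡ false → lookup x i ≡ lookup z i

  LocalPeakOfFace : Vec Bool n → Assignment n → Assignment n → Set
  LocalPeakOfFace S z x =
    InFace S z x × (∀ i → lookup S i ≡ true → f (flipAt x i) ≤ f x)

  Semismooth : Set
  Semismooth = ∀ (S : Vec Bool n) (z : Assignment n) →
    ∃[ x ] (LocalPeakOfFace S z x × (∀ x′ → LocalPeakOfFace S z x′ → x′ ≡ x))

  Smooth : Rel (Fin n) 0ℓ → Assignment n → Set
  Smooth _≺_ x* = ∀ (j : Fin n) (x : Assignment n) →
    (∀ i → i ≺ j → lookup x i ≡ lookup x* i) →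
    f (upd x j (not (lookup x* j))) < f (upd x j (lookup x* j))

  InPhiMinusDown : Rel (Fin n) 0ℓ → Assignment n → Fin n → Set
  InPhiMinusDown _≺_ x i = ∀ j → (j ≺ i ⊎ j ≡ i) → InPhiMinus x j

  IsChain : Rel (Fin n) 0ℓ → (Fin n → Set) → List (Fin n) → Set
  IsChain _≺_ T c = Linked _≺_ c × All T c

  IsHeight : Rel (Fin n) 0ℓ → Assignment n → ℕ → Set
  IsHeight _≺_ x h =
    let T = λ i → ¬ InPhiMinusDown _≺_ x i in
    (∃[ c ] (IsChain _≺_ T c × length c ≡ h)) ×
    (∀ c → IsChain _≺_ T c → length c Data.Nat.≤ h)

  -- lowest index i with S i maximizing g i (first maximizer in index order)
  argmaxFirst : (Fin n → ℤ) → Vec Bool n → List (Fin n) → Maybe (Fin n) → Maybe (Fin n)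
  argmaxFirst g S [] best = best
  argmaxFirst g S (i ∷ is) best with lookup S i
  ... | false = argmaxFirst g S is best
  ... | true with best
  ...   | nothing = argmaxFirst g S is (just i)
  ...   | just b with g b <? g i
  ...     | yes _ = argmaxFirst g S is (just i)
  ...     | no  _ = argmaxFirst g S is (just b)

  -- Kernighan–Lin neighbourhood (fuel k = |S| suffices; starts with k = n)
  klnGo : ℕ → Vec Bool n → Assignment n → List (Assignment n)
  klnGo zero S y = []
  klnGo (suc k) S y with argmaxFirst (λ i → f (flipAt y i)) S (toList (allFin n)) nothing
  ... | nothing = []
  ... | just i = flipAt y i ∷ klnGo k (S [ i ]≔ false) (flipAt y i)

  KLN : Assignment n → List (Assignment n)
  KLN x = klnGo n (Data.Vec.replicate n true) x

  KLStep : Assignment n → Assignment n → Set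
  KLStep x y = ¬ LocalPeak x × y ∈ KLN x × All (λ z → f z ≤ f y) (KLN x)

  data KLSteps : ℕ → Assignment n → Assignment n → Set where
    done : ∀ {x} → KLSteps zero x x
    step : ∀ {k x y z} → KLStep x y → KLSteps k y z → KLSteps (suc k) x z

-- Call bit i settled in x when x agrees with x* on i and on every j ≺ i; by smoothness the
-- settled bits of x are exactly φ⊖(x). Along the greedy path that builds KLN(x) a settled bit
-- is never flipped before the first descending move, since flipping it descends. After a
-- descent from y the path stays in the face spanned by the unflipped bits, of which y is a
-- local peak, so by semismoothness everything later is worse than y; hence the fittest element
-- of KLN(x) lies before the first descent. At that point every wrong bit whose predecessors
-- are all correct has been flipped, as flipping it would still improve. So after a step every
-- bit whose predecessors were correct is settled: φ⊖ only grows, and each bit outside the new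
-- φ⊖ has a predecessor outside the old one. A chain outside φ⊖ thus gains an element per step
-- backwards, so k steps from x⁰ give a chain of length k outside φ⊖(x⁰), and k ≤ height.
-- Since a non-peak always has a step and x* is the only local peak, the run reaches x*.

module Submission where

open import Defs
open import Data.Bool using (Bool)
open import Data.Nat using (ℕ; _≤_)
open import Data.Fin using (Fin)
open import Data.Product using (_×_; ∃-syntax)
open import Relation.Binary using (Rel; IsStrictPartialOrder)
open import Relation.Binary.PropositionalEquality using (_≡_)
open import Level using (0ℓ)

open import Data.Bool using (true; false; not; if_then_else_)
open import Data.Bool.Properties as Bool using (not-¬; ¬-not)
open import Data.Nat using (zero; suc; s≤s; s≤s⁻¹) renaming (_≤?_ to _≤ⁿ?_)
open import Data.Nat.Properties using (suc-injective)
open import Data.Integer using (ℤ) renaming (_≤_ to _≤ℤ_; _<_ to _<ℤ_)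
open import Data.Integer.Properties
  using (≤-refl; ≤-trans; <⇒≤; ≰⇒>; ≮⇒≥; <-asym; <-≤-trans; <⇒≱; _≤?_; _<?_)
  renaming (≤-totalOrder to ≤ℤ-totalOrder)
open import Data.Fin.Properties using (all?; ¬∀⟶∃¬) renaming (_≟_ to _≟ᶠ_)
open import Data.Fin.Subset using (Subset; ⊤; ∣_∣)
open import Data.Fin.Subset.Properties using (∣⊤∣≡n)
open import Data.Fin.Induction using (spo-wellFounded)
open import Induction.WellFounded using (Acc; acc)
open import Data.Vec using (Vec; []; _∷_; lookup; _[_]≔_; tabulate; allFin; toList)
open import Data.Vec.Properties
  using ( lookup∘update; lookup∘update′; lookup∘tabulate; tabulate-cong; tabulate∘lookup
        ; []≔-lookup; lookup-replicate)
open import Data.Vec.Membership.Propositional.Properties using (∈-allFin⁺; ∈-toList⁺)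
open import Data.Vec.Relation.Binary.Pointwise.Extensional using (ext; Pointwise-≡⇒≡)
open import Data.List using (List; []; _∷_; length)
open import Data.List.Membership.Propositional using (_∈_)
open import Data.List.Relation.Unary.Any using (here; there)
open import Data.List.Relation.Unary.All as All using (All; []; _∷_)
open import Data.List.Relation.Unary.Linked using ([]; [-]; _∷_)
import Data.List.Extrema ≤ℤ-totalOrder as Extrema
open import Data.Maybe using (Maybe; just; nothing)
open import Data.Maybe.Relation.Unary.All as Maybe using (just; nothing)
open import Data.Product as Product using (_,_; proj₁; proj₂)
open import Data.Sum using (inj₁; inj₂; [_,_]′)
open import Function using (_∘_)
open import Effect.Monad using (RawMonad)
open import Relation.Nullary using (¬_; Dec; yes; no; contradiction)
open import Relation.Nullary.Decidable using (decidable-stable; ¬?)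
open import Relation.Nullary.Negation using (¬¬-Monad)
open import Relation.Binary.PropositionalEquality
  using (_≢_; refl; sym; trans; cong; subst; subst₂)

∣p∣≡1+∣p[x]≔false∣ : ∀ {m} (p : Subset m) {x} → lookup p x ≡ true →
                     ∣ p ∣ ≡ suc ∣ p [ x ]≔ false ∣
∣p∣≡1+∣p[x]≔false∣ (true ∷ p) {Fin.zero} refl = refl
∣p∣≡1+∣p[x]≔false∣ (true ∷ p) {Fin.suc x} px =
  cong suc (∣p∣≡1+∣p[x]≔false∣ p px)
∣p∣≡1+∣p[x]≔false∣ (false ∷ p) {Fin.suc x} px =
  ∣p∣≡1+∣p[x]≔false∣ p px

∈∧∉⇒≢ : ∀ {m} {p : Subset m} {i j} → lookup p i ≡ true → lookup p j ≡ false → j ≢ i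
∈∧∉⇒≢ pi pj refl with () ← trans (sym pi) pj

differsAt : ∀ {m} {z y : Vec Bool m} i → lookup z i ≡ not (lookup y i) → z ≢ y
differsAt {y = y} i zi≡¬yi refl = not-¬ refl zi≡¬yi

boolVec-maximum : ∀ {m} (g : Vec Bool m → ℤ) → ∃[ v ] (∀ u → g u ≤ℤ g v)
boolVec-maximum {zero}  g = [] , λ { [] → ≤-refl }
boolVec-maximum {suc m} g with boolVec-maximum (g ∘ (true ∷_)) | boolVec-maximum (g ∘ (false ∷_))
... | t , t-max | u , u-max with g (true ∷ t) ≤? g (false ∷ u)
...   | yes t≤u = false ∷ u , λ { (true ∷ v) → ≤-trans (t-max v) t≤u
                                ; (false ∷ v) → u-max v }
...   | no  t≰u = true ∷ t  , λ { (true ∷ v) → t-max v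
                                ; (false ∷ v) → ≤-trans (u-max v) (<⇒≤ (≰⇒> t≰u)) }

list-argmax : ∀ {A : Set} (g : A → ℤ) {z : A} {zs : List A} → z ∈ zs →
              ∃[ m ] (m ∈ zs × All (λ y → g y ≤ℤ g m) zs)
list-argmax g {zs = z ∷ zs} _ =
  Extrema.argmax g z zs , [ here , there ]′ (Extrema.argmax-sel g z zs) ,
  Extrema.f[⊥]≤f[argmax] {f = g} z zs ∷ Extrema.f[xs]≤f[argmax] {f = g} z zs

module _ {n : ℕ} (f : Landscape n) where

  module _ (S : Subset n) (w : Assignment n) where

    toFace : Assignment n → Assignment n
    toFace z = tabulate λ i → if lookup S i then lookup z i else lookup w i

    toFace-inFace : ∀ z → InFace f S w (toFace z)
    toFace-inFace z i Si≡false =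
      trans (lookup∘tabulate _ i) (cong (if_then lookup z i else lookup w i) Si≡false)

    toFace-id : ∀ z → InFace f S w z → toFace z ≡ z
    toFace-id z z∈face = trans (tabulate-cong pick) (tabulate∘lookup z)
      where
      pick : ∀ i → (if lookup S i then lookup z i else lookup w i) ≡ lookup z i
      pick i with lookup S i in Si
      ... | true  = refl
      ... | false = sym (z∈face i Si)

    face-maximum : ∃[ m ] (InFace f S w m × (∀ z → InFace f S w z → f z ≤ℤ f m))
    face-maximum with boolVec-maximum (f ∘ toFace)
    ... | v , v-max = toFace v , toFace-inFace v , λ z z∈face →
                      subst (λ u → f u ≤ℤ f (toFace v)) (toFace-id z z∈face) (v-max z)

    flipAt-inFace : ∀ z {i} → InFace f S w z → lookup S i ≡ true → InFace f S w (flipAt z i)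
    flipAt-inFace z z∈face Si j Sj =
      trans (lookup∘update′ (∈∧∉⇒≢ {p = S} Si Sj) z _) (z∈face j Sj)

  module _ (semismooth : Semismooth f) (S : Subset n) (w : Assignment n) where

    facePeak-unique : ∀ {p q} → LocalPeakOfFace f S w p → LocalPeakOfFace f S w q → p ≡ q
    facePeak-unique {p} {q} p-peak q-peak with semismooth S w
    ... | _ , _ , unique = trans (unique p p-peak) (sym (unique q q-peak))

    -- The maximum of a face is one of its local peaks, hence its only one.
    facePeak-maximum : ∀ {p} → LocalPeakOfFace f S w p → ∀ z → InFace f S w z → f z ≤ℤ f p
    facePeak-maximum {p} p-peak z z∈face with face-maximum S w
    ... | m , m∈face , m-max =
      subst (λ u → f z ≤ℤ f u) (facePeak-unique m-peak p-peak) (m-max z z∈face)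
      where
      m-peak : LocalPeakOfFace f S w m
      m-peak = m∈face , λ i Si → m-max _ (flipAt-inFace S w m m∈face Si)

    facePeak-strictMaximum : ∀ {p} → LocalPeakOfFace f S w p →
                             ∀ z → InFace f S w z → z ≢ p → f z <ℤ f p
    facePeak-strictMaximum {p} p-peak z z∈face z≢p with f p ≤? f z
    ... | no  p≰z = ≰⇒> p≰z
    ... | yes p≤z = contradiction (facePeak-unique z-peak p-peak) z≢p
      where
      z-peak : LocalPeakOfFace f S w z
      z-peak = z∈face , λ i Si →
        ≤-trans (facePeak-maximum p-peak _ (flipAt-inFace S w z z∈face Si)) p≤z

  module _ (g : Fin n → ℤ) (S : Subset n) where

    data ArgMax (is : List (Fin n)) : Maybe (Fin n) → Maybe (Fin n) → Set where
      none : (∀ {j} → j ∈ is → lookup S j ≡ false) → ArgMax is nothing nothing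
      some : ∀ {best i} → lookup S i ≡ true →
             (∀ {j} → j ∈ is → lookup S j ≡ true → g j ≤ℤ g i) →
             Maybe.All (λ b → g b ≤ℤ g i) best → ArgMax is best (just i)

    private
      skip : ∀ {i is best r} → lookup S i ≡ false → ArgMax is best r → ArgMax (i ∷ is) best r
      skip Si (none empty) = none λ { (here refl) → Si ; (there j∈) → empty j∈ }
      skip Si (some Sk max best≤k) =
        some Sk (λ { (here refl) Sj → contradiction (trans (sym Si) Sj) λ ()
                   ; (there j∈)  → max j∈ })
             best≤k

      consider : ∀ {i is best c r} → ArgMax is (just c) r →
                 (∀ {k} → g c ≤ℤ g k →
                          g i ≤ℤ g k × Maybe.All (λ b → g b ≤ℤ g k) best) →
                 ArgMax (i ∷ is) best r
      consider (some Sk max (just c≤k)) dominated =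
        some Sk (λ { (here refl) _ → proj₁ (dominated c≤k)
                   ; (there j∈)  → max j∈ })
             (proj₂ (dominated c≤k))

    argmaxFirst-view : ∀ is best → Maybe.All (λ b → lookup S b ≡ true) best →
                       ArgMax is best (argmaxFirst f g S is best)
    argmaxFirst-view []       nothing  nothing   = none λ ()
    argmaxFirst-view []       (just b) (just Sb) = some Sb (λ ()) (just ≤-refl)
    argmaxFirst-view (i ∷ is) nothing  nothing with lookup S i in Si
    ... | false = skip Si (argmaxFirst-view is nothing nothing)
    ... | true  = consider (argmaxFirst-view is (just i) (just Si)) λ i≤k → i≤k , nothing
    argmaxFirst-view (i ∷ is) (just b) (just Sb) with lookup S i in Si
    ... | false = skip Si (argmaxFirst-view is (just b) (just Sb))
    ... | true with g b <? g i
    ...   | yes b<i = consider (argmaxFirst-view is (just i) (just Si))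
                               λ i≤k → i≤k , just (≤-trans (<⇒≤ b<i) i≤k)
    ...   | no  b≮i = consider (argmaxFirst-view is (just b) (just Sb))
                               λ b≤k → ≤-trans (≮⇒≥ b≮i) b≤k , just b≤k

  -- The runs of klnGo, forgetting its tie-breaking and its fuel.
  data Greedy : Subset n → Assignment n → List (Assignment n) → Set where
    stop : ∀ {S y} → (∀ j → lookup S j ≢ true) → Greedy S y []
    move : ∀ {S y i zs} → lookup S i ≡ true →
           (∀ {j} → lookup S j ≡ true → f (flipAt y j) ≤ℤ f (flipAt y i)) →
           Greedy (S [ i ]≔ false) (flipAt y i) zs → Greedy S y (flipAt y i ∷ zs)

  klnGo-greedy : ∀ k S y → ∣ S ∣ ≡ k → Greedy S y (klnGo f k S y)
  klnGo-greedy zero S y ∣S∣≡0 =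
    stop λ j Sj → contradiction (trans (sym ∣S∣≡0) (∣p∣≡1+∣p[x]≔false∣ S Sj)) λ ()
  klnGo-greedy (suc k) S y ∣S∣≡1+k
    with argmaxFirst f (λ i → f (flipAt y i)) S (toList (allFin n)) nothing
       | argmaxFirst-view (λ i → f (flipAt y i)) S (toList (allFin n)) nothing nothing
  ... | nothing | none empty =
    stop λ j Sj → contradiction (trans (sym Sj) (empty (∈-toList⁺ (∈-allFin⁺ j)))) λ ()
  ... | just i  | some Si max _ =
    move Si (max (∈-toList⁺ (∈-allFin⁺ _))) (klnGo-greedy k _ _ ∣S′∣≡k)
    where
    ∣S′∣≡k = suc-injective (trans (sym (∣p∣≡1+∣p[x]≔false∣ S Si)) ∣S∣≡1+k)

  KLN-greedy : ∀ x → Greedy ⊤ x (KLN f x)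
  KLN-greedy x = klnGo-greedy n ⊤ x (∣⊤∣≡n n)

  greedy-head : ∀ {S y zs l} → Greedy S y zs → lookup S l ≡ true →
                ∃[ z ] (z ∈ zs × f (flipAt y l) ≤ℤ f z)
  greedy-head (stop empty)   Sl = contradiction Sl (empty _)
  greedy-head (move _ max _) Sl = _ , here refl , max Sl

  greedy-inFace : ∀ {S y zs} → Greedy S y zs → All (λ z → InFace f S y z × z ≢ y) zs
  greedy-inFace (stop _) = []
  greedy-inFace {S} {y} (move {i = i} Si _ rest) =
    (flipAt-inFace S y y (λ _ _ → refl) Si , differsAt i (lookup∘update i y _)) ∷
    All.map shrink (greedy-inFace rest)
    where
    shrink : ∀ {z} → InFace f (S [ i ]≔ false) (flipAt y i) z × z ≢ flipAt y i →
             InFace f S y z × z ≢ y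
    shrink (z∈face , _) =
      (λ j Sj → let j≢i = ∈∧∉⇒≢ {p = S} Si Sj in
                trans (z∈face j (trans (lookup∘update′ j≢i S false) Sj))
                      (lookup∘update′ j≢i y _)) ,
      differsAt i (trans (z∈face i (lookup∘update i S false)) (lookup∘update i y _))

  greedy-belowFacePeak : Semismooth f → ∀ {S y zs} → Greedy S y zs → LocalPeakOfFace f S y y →
                         All (λ z → f z <ℤ f y) zs
  greedy-belowFacePeak semismooth {S} {y} path y-peak =
    All.map (λ {z} (z∈face , z≢y) → facePeak-strictMaximum semismooth S y y-peak z z∈face z≢y)
            (greedy-inFace path)

  localPeak? : ∀ x → Dec (LocalPeak f x)
  localPeak? x = all? λ i → ¬? (f x <? f (flipAt x i))

  ¬localPeak⇒improvable : ∀ {x} → ¬ LocalPeak f x → ∃[ i ] InPhiPlus f x i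
  ¬localPeak⇒improvable {x} ¬peak with ¬∀⟶∃¬ n _ (λ i → ¬? (f x <? f (flipAt x i))) ¬peak
  ... | i , ¬¬improves = i , decidable-stable (f x <? f (flipAt x i)) ¬¬improves

  klStep-exists : ∀ {x} → ¬ LocalPeak f x → ∃[ y ] KLStep f x y
  klStep-exists {x} ¬peak with ¬localPeak⇒improvable ¬peak
  ... | j , _ with greedy-head (KLN-greedy x) (lookup-replicate j true)
  ... | z , z∈ , _ with list-argmax f z∈
  ... | y , y∈ , y-max = y , ¬peak , y∈ , y-max

  klStep-improves : ∀ {x y} → KLStep f x y → f x <ℤ f y
  klStep-improves {x} (¬peak , _ , y-max) with ¬localPeak⇒improvable ¬peak
  ... | j , x<x[j] with greedy-head (KLN-greedy x) (lookup-replicate j true)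
  ... | z , z∈ , x[j]≤z = <-≤-trans x<x[j] (≤-trans x[j]≤z (All.lookup y-max z∈))

module ConditionallySmooth {n : ℕ} (f : Landscape n) (_≺_ : Rel (Fin n) 0ℓ)
  (≺-isStrictPartialOrder : IsStrictPartialOrder _≡_ _≺_)
  (x* : Assignment n) (smooth : Smooth f _≺_ x*) where

  open IsStrictPartialOrder ≺-isStrictPartialOrder using () renaming (trans to ≺-trans)

  Correct : Assignment n → Fin n → Set
  Correct x i = lookup x i ≡ lookup x* i

  Below : Assignment n → Fin n → Set
  Below x i = ∀ j → j ≺ i → Correct x j

  Settled : Assignment n → Fin n → Set
  Settled x i = Below x i × Correct x i

  below-≺ : ∀ {x i j} → Below x i → j ≺ i → Settled x j
  below-≺ below j≺i = (λ k k≺j → below k (≺-trans k≺j j≺i)) , below _ j≺i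

  flipAt-settled-decreases : ∀ {x i} → Settled x i → f (flipAt x i) <ℤ f x
  flipAt-settled-decreases {x} {i} (below , correct) =
    subst₂ _<ℤ_ flipped unchanged (smooth i x below)
    where
    flipped : f (upd x i (not (lookup x* i))) ≡ f (flipAt x i)
    flipped = cong (λ b → f (upd x i (not b))) (sym correct)
    unchanged : f (upd x i (lookup x* i)) ≡ f x
    unchanged = cong f (trans (cong (upd x i) (sym correct)) ([]≔-lookup x i))

  flipAt-wrong-increases : ∀ {x i} → Below x i → ¬ Correct x i → f x <ℤ f (flipAt x i)
  flipAt-wrong-increases {x} {i} below wrong =
    subst₂ _<ℤ_ unchanged flipped (smooth i x below)
    where
    unchanged : f (upd x i (not (lookup x* i))) ≡ f x
    unchanged = cong f (trans (cong (upd x i) (sym (¬-not wrong))) ([]≔-lookup x i))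
    flipped : f (upd x i (lookup x* i)) ≡ f (flipAt x i)
    flipped = cong (f ∘ upd x i) (¬-not (wrong ∘ sym))

  settled⇒φ⊖ : ∀ {x i} → Settled x i → InPhiMinusDown f _≺_ x i
  settled⇒φ⊖ {x} (below , _) j (inj₁ j≺i) x<x[j] =
    <-asym x<x[j] (flipAt-settled-decreases (below-≺ {x} below j≺i))
  settled⇒φ⊖ settled j (inj₂ refl) x<x[j] =
    <-asym x<x[j] (flipAt-settled-decreases settled)

  φ⊖⇒settled : ∀ {x i} → InPhiMinusDown f _≺_ x i → Settled x i
  φ⊖⇒settled {x} {i} = go i (spo-wellFounded ≺-isStrictPartialOrder i)
    where
    go : ∀ i → Acc _≺_ i → InPhiMinusDown f _≺_ x i → Settled x i
    go i (acc rs) φ⊖ = below , decidable-stable (lookup x i Bool.≟ lookup x* i) correct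
      where
      below : Below x i
      below j j≺i = proj₂ (go j (rs j≺i) λ
        { k (inj₁ k≺j) → φ⊖ k (inj₁ (≺-trans k≺j j≺i))
        ; k (inj₂ refl) → φ⊖ k (inj₁ j≺i) })
      correct : ¬ ¬ Correct x i
      correct wrong = φ⊖ i (inj₂ refl) (flipAt-wrong-increases below wrong)

  localPeak⇒≡x* : ∀ {x} → LocalPeak f x → x ≡ x*
  localPeak⇒≡x* peak = Pointwise-≡⇒≡ (ext λ i → proj₂ (φ⊖⇒settled λ j _ → peak j))

  klSteps-reach-x* : ∀ d x → (∀ {k y} → KLSteps f k x y → k ≤ d) → ∃[ k ] KLSteps f k x x*
  klSteps-reach-x* d x bounded with localPeak? f x
  ... | yes peak = 0 , subst (KLSteps f 0 x) (localPeak⇒≡x* peak) done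
  ... | no ¬peak with klStep-exists f ¬peak
  ...   | y , st with bounded (step st done)
  ...     | s≤s _ =
    Product.map suc (step st) (klSteps-reach-x* _ y λ run → s≤s⁻¹ (bounded (step st run)))

  module KernighanLin (semismooth : Semismooth f) where

    -- S is the set of bits not yet flipped on the greedy path from x to y.
    record Invariant (x : Assignment n) (S : Subset n) (y : Assignment n) : Set where
      field
        unflipped : ∀ {j} → lookup S j ≡ true → lookup y j ≡ lookup x j
        flipped   : ∀ {j} → lookup S j ≡ false → lookup y j ≡ not (lookup x j)
        keeps     : ∀ {j} → Settled x j → lookup S j ≡ true

      correct : ∀ {j} → Settled x j → Correct y j
      correct settled = trans (unflipped (keeps settled)) (proj₂ settled)

      settled : ∀ {j} → Settled x j → Settled y j
      settled (below , correct-x) =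
        (λ k k≺j → correct (below-≺ {x} below k≺j)) , correct (below , correct-x)

    open Invariant

    invariant-start : ∀ x → Invariant x ⊤ x
    invariant-start x = record
      { unflipped = λ _ → refl
      ; flipped   = λ {j} ⊤[j] → contradiction (trans (sym (lookup-replicate j true)) ⊤[j]) λ ()
      ; keeps     = λ {j} _ → lookup-replicate j true
      }

    -- Flipping a settled bit descends, so an ascending move never flips one.
    invariant-ascent : ∀ {x S y i} → Invariant x S y → lookup S i ≡ true →
                       ¬ f (flipAt y i) <ℤ f y → Invariant x (S [ i ]≔ false) (flipAt y i)
    invariant-ascent {x} {S} {y} {i} inv Si ascent = record
      { unflipped = unflipped′
      ; flipped   = flipped′
      ; keeps     = λ s → trans (lookup∘update′ (i-unsettled s) S false) (keeps inv s)
      }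
      where
      i-unsettled : ∀ {j} → Settled x j → j ≢ i
      i-unsettled s refl = ascent (flipAt-settled-decreases (settled inv s))
      unflipped′ : ∀ {j} → lookup (S [ i ]≔ false) j ≡ true → lookup (flipAt y i) j ≡ lookup x j
      unflipped′ {j} S′[j] with j ≟ᶠ i
      ... | yes refl = contradiction (trans (sym S′[j]) (lookup∘update i S false)) λ ()
      ... | no  j≢i  = trans (lookup∘update′ j≢i y _)
                             (unflipped inv (trans (sym (lookup∘update′ j≢i S false)) S′[j]))
      flipped′ : ∀ {j} → lookup (S [ i ]≔ false) j ≡ false →
                 lookup (flipAt y i) j ≡ not (lookup x j)
      flipped′ {j} S′[j] with j ≟ᶠ i
      ... | yes refl = trans (lookup∘update i y _) (cong not (unflipped inv Si))
      ... | no  j≢i  = trans (lookup∘update′ j≢i y _)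
                             (flipped inv (trans (sym (lookup∘update′ j≢i S false)) S′[j]))

    -- A wrong bit l with correct predecessors would still be unflipped in y, and flipping it
    -- would improve on y and hence on the rest of the path.
    greedy-top-settles : ∀ {x S y zs l} → Greedy f S y zs → Invariant x S y →
                         All (λ z → f z ≤ℤ f y) zs → Below x l → Settled y l
    greedy-top-settles {x} {S} {y} {l = l} path inv y-max below = below-y , correct-l
      where
      below-y : Below y l
      below-y j j≺l = correct inv (below-≺ {x} below j≺l)
      correct-l : Correct y l
      correct-l with lookup x l Bool.≟ lookup x* l
      ... | yes x-correct = correct inv (below , x-correct)
      ... | no  x-wrong with lookup S l in Sl
      ...   | false = trans (flipped inv Sl) (sym (¬-not (x-wrong ∘ sym)))
      ...   | true with greedy-head f path Sl
      ...     | z , z∈ , y[l]≤z =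
        contradiction (≤-trans y[l]≤z (All.lookup y-max z∈))
                      (<⇒≱ (flipAt-wrong-increases below-y
                                                   (x-wrong ∘ trans (sym (unflipped inv Sl)))))

    greedy-settles : ∀ {x S y zs y′ l} → Greedy f S y zs → Invariant x S y → f y ≤ℤ f y′ →
                     y′ ∈ zs → All (λ z → f z ≤ℤ f y′) zs → Below x l → Settled y′ l
    greedy-settles path@(move {S} {y} {i} Si best rest) inv y≤y′ y′∈ y′-max
      with f (flipAt y i) <? f y
    ... | yes descent =
      contradiction y≤y′ (<⇒≱ (All.lookup (greedy-belowFacePeak f semismooth path y-peak) y′∈))
      where
      y-peak : LocalPeakOfFace f S y y
      y-peak = (λ _ _ → refl) , λ j Sj → ≤-trans (best Sj) (<⇒≤ descent)
    ... | no ascent with y′∈ | y′-max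
    ...   | here refl     | _ ∷ rest-max =
      greedy-top-settles rest (invariant-ascent inv Si ascent) rest-max
    ...   | there y′∈rest | y[i]≤y′ ∷ rest-max =
      greedy-settles rest (invariant-ascent inv Si ascent) y[i]≤y′ y′∈rest rest-max

    klStep-settles : ∀ {x y l} → KLStep f x y → Below x l → Settled y l
    klStep-settles {x} st@(_ , y∈ , y-max) =
      greedy-settles (KLN-greedy f x) (invariant-start x) (<⇒≤ (klStep-improves f st))
                     y∈ y-max

    Unsettled : Assignment n → Fin n → Set
    Unsettled x i = ¬ InPhiMinusDown f _≺_ x i

    klStep-unsettled : ∀ {x y i} → KLStep f x y → Unsettled y i → Unsettled x i
    klStep-unsettled st unsettled φ⊖ =
      unsettled (settled⇒φ⊖ (klStep-settles st (proj₁ (φ⊖⇒settled φ⊖))))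

    -- ≺ need not be decidable, so the predecessor is only obtained under double negation.
    klStep-unsettled-≺ : ∀ {x y i} → KLStep f x y → Unsettled y i →
                         ¬ ¬ (∃[ j ] (j ≺ i × Unsettled x j))
    klStep-unsettled-≺ {x} {i = i} st unsettled no-witness =
      unsettled (settled⇒φ⊖ (klStep-settles st below))
      where
      below : Below x i
      below j j≺i = decidable-stable (lookup x j Bool.≟ lookup x* j) λ wrong →
        no-witness (j , j≺i , wrong ∘ proj₂ ∘ φ⊖⇒settled)

    open RawMonad (¬¬-Monad {0ℓ})

    klStep-lengthensChain : ∀ {x y} c → KLStep f x y → IsChain f _≺_ (Unsettled y) c →
                            ¬ ¬ (∃[ c′ ] (IsChain f _≺_ (Unsettled x) c′ ×
                                          length c′ ≡ suc (length c)))
    klStep-lengthensChain [] st@(¬peak , _) _ with ¬localPeak⇒improvable f ¬peak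
    ... | j , x<x[j] = pure (j ∷ [] , ([-] , (λ φ⊖ → φ⊖ j (inj₂ refl) x<x[j]) ∷ []) , refl)
    klStep-lengthensChain (c₁ ∷ cs) st (links , unsettled@(unsettled₁ ∷ _)) = do
      j , j≺c₁ , unsettled-j ← klStep-unsettled-≺ st unsettled₁
      pure ( j ∷ c₁ ∷ cs
           , (j≺c₁ ∷ links , unsettled-j ∷ All.map (klStep-unsettled st) unsettled)
           , refl)

    klSteps-chain : ∀ {k x z} → KLSteps f k x z →
                    ¬ ¬ (∃[ c ] (IsChain f _≺_ (Unsettled x) c × length c ≡ k))
    klSteps-chain done          = pure ([] , ([] , []) , refl)
    klSteps-chain (step st run) = do
      c , chain , length≡k ← klSteps-chain run
      c′ , chain′ , length≡1+k ← klStep-lengthensChain c st chain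
      pure (c′ , chain′ , trans length≡1+k (cong suc length≡k))

    klSteps-bounded : ∀ {x h k z} → IsHeight f _≺_ x h → KLSteps f k x z → k ≤ h
    klSteps-bounded {h = h} {k} (_ , longest) run =
      decidable-stable (k ≤ⁿ? h) do
        c , chain , length≡k ← klSteps-chain run
        pure (subst (_≤ h) length≡k (longest c chain))

propositionC10 : ∀ {n : ℕ} (f : Landscape n) (_≺_ : Rel (Fin n) 0ℓ) →
    IsStrictPartialOrder _≡_ _≺_ → (x* : Assignment n) → Smooth f _≺_ x* →
    Semismooth f → (x⁰ : Assignment n) (h : ℕ) → IsHeight f _≺_ x⁰ h →
    (∀ k x → KLSteps f k x⁰ x → k ≤ h) × (∃[ k ] (k ≤ h × KLSteps f k x⁰ x*))
propositionC10 f _≺_ ≺-isStrictPartialOrder x* smooth semismooth x⁰ h height =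
  bounded , (proj₁ reached , bounded _ _ (proj₂ reached) , proj₂ reached)
  where
  open ConditionallySmooth f _≺_ ≺-isStrictPartialOrder x* smooth
  open KernighanLin semismooth

  bounded : ∀ k x → KLSteps f k x⁰ x → k ≤ h
  bounded _ _ = klSteps-bounded height

  reached : ∃[ k ] KLSteps f k x⁰ x*
  reached = klSteps-reach-x* h x⁰ (bounded _ _)
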